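{- For each $n\ge1$, $$\sum_{\pi\in\mathfrak S_{2n}}t^{\mathrm{exc}(\pi)}y^{\mathrm{fix}(\pi)}=\sum_{\pi\in\mathfrak S_{2n}}t^{\mathrm{exph}(\pi)}y^{\mathrm{fix}(\pi)}.$$
   Context: $\mathfrak S_{2n}$ is the set of permutations of $[2n]$. $\mathrm{exc}(\pi)=\#\{i:\pi(i)>i\}$, $\mathrm{fix}(\pi)=\#\{i:\pi(i)=i\}$. For $\pi\in\mathfrak S_{2n}$, an index $i\in[2n]$ is counted by $\mathrm{exph}(\pi)$ if it satisfies one of: (I) $1\le i<\pi(i)\le n$; (II) $n+1\le i\le 2n$ and $i-n\le\pi(i)\le n$; (III) $n+1\le i<\pi(i)\le 2n$; (IV) $1\le i<\pi(i)-n$ and $n+1\le\pi(i)\le 2n$. $t,y$ are indeterminates. -}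

module Defs where

open import Level using (Level)
open import Data.Nat using (ℕ; zero; suc; _+_; _*_; _<_; _≤_; _<?_; _≤?_)
open import Data.Fin using (Fin; toℕ; _≟_)
open import Data.List using (List; []; _∷_; [_]; map; concatMap; filter; allFin; length; foldr)
open import Data.Vec using (Vec; lookup; toList) renaming (_∷_ to _∷ᵥ_; [] to []ᵥ)
open import Data.Product using (_×_)
open import Data.Sum using (_⊎_)
open import Relation.Nullary using (Dec)
open import Relation.Nullary.Decidable using (_×-dec_; _⊎-dec_)
open import Relation.Binary.PropositionalEquality using (_≡_)
open import Data.Nat.Properties using () renaming (_≟_ to _≟ℕ_)
open import Algebra.Bundles using (CommutativeSemiring)
import Data.List.Relation.Unary.Unique.DecPropositional as UDP

private module UP (m : ℕ) = UDP (_≟_ {m})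

allVecs : (k m : ℕ) → List (Vec (Fin m) k)
allVecs zero m = [ []ᵥ ]
allVecs (suc k) m = concatMap (λ v → map (_∷ᵥ v) (allFin m)) (allVecs k m)

Perms : (m : ℕ) → List (Fin m → Fin m)
Perms m = map lookup (filter (λ v → UP.unique? m (toList v)) (allVecs m m))

countFin : (m : ℕ) {P : Fin m → Set} → ((i : Fin m) → Dec (P i)) → ℕ
countFin m P? = length (filter P? (allFin m))

-- 1-based value of a position / entry (Fin m = {0,…,m-1} encodes [m] = {1,…,m})
val : {m : ℕ} → Fin m → ℕ
val i = suc (toℕ i)

exc : (m : ℕ) → (Fin m → Fin m) → ℕ
exc m π = countFin m (λ i → val i <? val (π i))

fix : (m : ℕ) → (Fin m → Fin m) → ℕ
fix m π = countFin m (λ i → val (π i) ≟ℕ val i)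

-- exph(π) for π ∈ S_{2n}; with i = val i, p = val (π i) ∈ [2n]:
-- (I)   1 ≤ i < p ≤ n
-- (II)  n+1 ≤ i ≤ 2n and i-n ≤ p ≤ n      (i - n ≤ p written as i ≤ p + n)
-- (III) n+1 ≤ i < p ≤ 2n
-- (IV)  1 ≤ i < p - n and n+1 ≤ p ≤ 2n    (i < p - n written as i + n < p)
-- (the bounds 1 ≤ i, i ≤ 2n, p ≤ 2n hold automatically)
exphAt : (n i p : ℕ) → Dec (((i < p) × (p ≤ n))
                           ⊎ (((n < i) × ((i ≤ p + n) × (p ≤ n)))
                           ⊎ (((n < i) × (i < p))
                           ⊎ ((i + n < p) × (n < p)))))
exphAt n i p = ((i <? p) ×-dec (p ≤? n))
          ⊎-dec (((n <? i) ×-dec ((i ≤? p + n) ×-dec (p ≤? n)))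
          ⊎-dec (((n <? i) ×-dec (i <? p))
          ⊎-dec ((i + n <? p) ×-dec (n <? p))))

exph : (n : ℕ) → (Fin (2 * n) → Fin (2 * n)) → ℕ
exph n π = countFin (2 * n) (λ i → exphAt n (val i) (val (π i)))

-- Evaluation of the generating polynomial Σ_{π ∈ S_m} t^{stat π} y^{fix π}
-- in an arbitrary commutative semiring R at t, y ∈ R.  Equality of these
-- for every R, t, y is equality in ℕ[t,y] (take R = ℕ[t,y]).
module _ {c ℓ : Level} (R : CommutativeSemiring c ℓ) where
  open CommutativeSemiring R using (Carrier; 1#; 0#) renaming (_*_ to _·_; _+_ to _⊕_)

  pow : Carrier → ℕ → Carrier
  pow x zero = 1#
  pow x (suc k) = x · pow x k

  genPoly : (m : ℕ) → ((Fin m → Fin m) → ℕ) → Carrier → Carrier → Carrier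
  genPoly m stat t y = foldr (λ π acc → (pow t (stat π) · pow y (fix m π)) ⊕ acc) 0# (Perms m)

-- Let σ be the permutation of [2n] with σ(i) = 2i and σ(n + i) = 2i − 1 for i ∈ [n].  Checking the
-- four regions (i ≤ n or i > n, π(i) ≤ n or π(i) > n) shows that i is counted by exph(π) exactly
-- when σ(i) < σ(π(i)).  Hence exc(σπσ⁻¹) = exph(π) and fix(σπσ⁻¹) = fix(π), and since conjugation
-- by σ permutes 𝔖_{2n}, the two generating polynomials have the same terms.

module Submission where

open import Defs
open import Level using (Level)
open import Data.Nat using (ℕ; zero; suc; _+_; _*_; _∸_; _≤_; _<_; s≤s; z≤n; _<?_)
open import Data.Nat.Properties
  using ( suc-injective; ≤-pred; ≤-trans; <-trans; <-≤-trans; <⇒≤; <⇒≱; ≤⇒≯; ≮⇒≥; n≤1+n; m≤m+n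
        ; +-suc; +-comm; +-identityʳ; +-monoʳ-≤; +-monoˡ-≤; +-monoʳ-<; +-cancelˡ-≤; +-cancelˡ-<
        ; ∸-monoˡ-<; m+n∸m≡n; m+[n∸m]≡n )
  renaming (_≟_ to _≟ℕ_)
open import Data.Fin using (Fin; toℕ; fromℕ<; _≟_)
open import Data.Fin.Properties using (toℕ-injective; toℕ<n; toℕ-fromℕ<)
open import Data.Fin.Permutation using (Permutation′; _⟨$⟩ʳ_; _⟨$⟩ˡ_; inverseˡ; inverseʳ; flip)
open import Data.List using (List; []; _∷_; map; filter; allFin; length; foldr)
open import Data.List.Properties using (filter-≐; foldr-map; map-∘; map-cong)
open import Data.Vec using (Vec; lookup; toList; tabulate) renaming (_∷_ to _∷ᵥ_; [] to []ᵥ)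
open import Data.Vec.Properties
  using (lookup∘tabulate; tabulate∘lookup; tabulate-cong; ∷-injectiveˡ; ∷-injectiveʳ)
open import Data.Product using (_×_; _,_; proj₂)
open import Data.Sum using (_⊎_; inj₁; inj₂)
open import Function using (_∘_; _⇔_; mk⇔; mk↔ₛ′; Equivalence; Injection)
open import Function.Properties.Inverse using (↔⇒↣)
open import Function.Construct.Composition using (_⇔-∘_)
open import Function.Construct.Identity using (⇔-id)
open import Function.Construct.Symmetry using (⇔-sym)
open import Relation.Nullary using (¬_; Dec; yes; no; contradiction)
open import Relation.Unary using (Pred; Decidable)
open import Relation.Binary.PropositionalEquality
  using (_≡_; _≢_; refl; sym; trans; cong; cong₂; subst; module ≡-Reasoning)
open import Algebra.Bundles using (CommutativeSemiring)
open import Data.List.Relation.Unary.All as All using ([]; _∷_)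
import Data.List.Relation.Unary.All.Properties as Allₚ
open import Data.List.Relation.Unary.Any as Any using (here)
open import Data.List.Relation.Unary.AllPairs as AllPairs using ([]; _∷_)
import Data.List.Relation.Unary.AllPairs.Properties as AllPairsₚ
open import Data.List.Relation.Unary.Unique.Propositional using (Unique)
import Data.List.Relation.Unary.Unique.Propositional.Properties as Uniqueₚ
import Data.List.Relation.Unary.Unique.DecPropositional as DecUnique
open import Data.List.Relation.Binary.Disjoint.Propositional using (Disjoint)
open import Data.List.Membership.Propositional using (_∈_)
open import Data.List.Membership.Propositional.Properties
  using (∈-map⁺; ∈-map⁻; ∈-filter⁺; ∈-filter⁻; ∈-allFin; ∈-concatMap⁺)
open import Data.List.Membership.Propositional.Properties.WithK using (unique∧set⇒bag)
open import Data.List.Relation.Binary.BagAndSetEquality using (∼bag⇒↭)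
open import Data.List.Relation.Binary.Permutation.Propositional using (_↭_; ↭-sym; ↭⇒↭ₛ′)
open import Data.List.Relation.Binary.Permutation.Propositional.Properties
  using (filter-↭; ↭-length) renaming (map⁺ to ↭-map⁺)
open import Data.List.Relation.Binary.Permutation.Setoid.Properties using (foldr-commMonoid)
open import Data.Vec.Relation.Unary.AllPairs using ([]; _∷_)
import Data.Vec.Relation.Unary.All.Properties as VecAllₚ
import Data.Vec.Relation.Unary.Unique.Propositional as Vec
import Data.Vec.Relation.Unary.Unique.Propositional.Properties as VecUniqueₚ

private variable
  a p : Level
  A B : Set a
  k m : ℕ

map-bijection-↭ : (f g : A → A) {xs : List A} → Unique xs →
                  (∀ x → g (f x) ≡ x) → (∀ y → f (g y) ≡ y) →
                  (∀ {x} → x ∈ xs → f x ∈ xs) → (∀ {y} → y ∈ xs → g y ∈ xs) →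
                  map f xs ↭ xs
map-bijection-↭ f g {xs} xs! gf fg f-closed g-closed =
  ∼bag⇒↭ (unique∧set⇒bag (Uniqueₚ.map⁺ f-injective xs!) xs! (mk⇔ to from))
  where
  f-injective : ∀ {x y} → f x ≡ f y → x ≡ y
  f-injective {x} {y} fx≡fy = trans (sym (gf x)) (trans (cong g fx≡fy) (gf y))
  to : ∀ {z} → z ∈ map f xs → z ∈ xs
  to z∈ with ∈-map⁻ f z∈
  ... | x , x∈ , refl = f-closed x∈
  from : ∀ {z} → z ∈ xs → z ∈ map f xs
  from {z} z∈ = subst (_∈ map f xs) (fg z) (∈-map⁺ f (g-closed z∈))

length-filter-map : {P : Pred B p} (P? : Decidable P) (f : A → B) (xs : List A) →
                    length (filter P? (map f xs)) ≡ length (filter (P? ∘ f) xs)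
length-filter-map P? f [] = refl
length-filter-map P? f (x ∷ xs) with P? (f x)
... | yes _ = cong suc (length-filter-map P? f xs)
... | no _ = length-filter-map P? f xs

countFin-cong : {P Q : Fin m → Set} (P? : Decidable P) (Q? : Decidable Q) →
                (∀ i → P i ⇔ Q i) → countFin m P? ≡ countFin m Q?
countFin-cong {m} P? Q? P⇔Q =
  cong length (filter-≐ P? Q? ((λ {i} → Equivalence.to (P⇔Q i)) , (λ {i} → Equivalence.from (P⇔Q i)))
                        (allFin m))

countFin-reindex : (σ : Permutation′ m) {P Q : Fin m → Set}
                   (P? : Decidable P) (Q? : Decidable Q) →
                   (∀ i → P (σ ⟨$⟩ʳ i) ⇔ Q i) → countFin m P? ≡ countFin m Q?
countFin-reindex {m} σ P? Q? P∘σ⇔Q = begin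
  length (filter P? (allFin m))               ≡⟨ ↭-length (filter-↭ P? (↭-sym σ-permutes)) ⟩
  length (filter P? (map (σ ⟨$⟩ʳ_) (allFin m))) ≡⟨ length-filter-map P? (σ ⟨$⟩ʳ_) (allFin m) ⟩
  countFin m (P? ∘ (σ ⟨$⟩ʳ_))                  ≡⟨ countFin-cong (P? ∘ (σ ⟨$⟩ʳ_)) Q? P∘σ⇔Q ⟩
  countFin m Q?                               ∎
  where
  open ≡-Reasoning
  σ-permutes : map (σ ⟨$⟩ʳ_) (allFin m) ↭ allFin m
  σ-permutes = map-bijection-↭ (σ ⟨$⟩ʳ_) (σ ⟨$⟩ˡ_) (Uniqueₚ.allFin⁺ m)
    (λ _ → inverseˡ σ) (λ _ → inverseʳ σ) (λ _ → ∈-allFin _) (λ _ → ∈-allFin _)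

countGraph : (m : ℕ) {P : Fin m → Fin m → Set} → (∀ i j → Dec (P i j)) → (Fin m → Fin m) → ℕ
countGraph m P? π = countFin m (λ i → P? i (π i))

conjugate : Permutation′ m → (Fin m → Fin m) → (Fin m → Fin m)
conjugate σ π = (σ ⟨$⟩ʳ_) ∘ π ∘ (σ ⟨$⟩ˡ_)

conjugate-⟨$⟩ʳ : (σ : Permutation′ m) (π : Fin m → Fin m) (i : Fin m) →
                 conjugate σ π (σ ⟨$⟩ʳ i) ≡ σ ⟨$⟩ʳ π i
conjugate-⟨$⟩ʳ σ π i = cong ((σ ⟨$⟩ʳ_) ∘ π) (inverseˡ σ)

⟨$⟩ʳ-injective : (σ : Permutation′ m) {i j : Fin m} → σ ⟨$⟩ʳ i ≡ σ ⟨$⟩ʳ j → i ≡ j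
⟨$⟩ʳ-injective σ = Injection.injective (↔⇒↣ σ)

countGraph-cong : {P : Fin m → Fin m → Set} (P? : ∀ i j → Dec (P i j)) {π π′ : Fin m → Fin m} →
                  (∀ i → π i ≡ π′ i) → countGraph m P? π ≡ countGraph m P? π′
countGraph-cong {P = P} P? {π} π≗π′ =
  countFin-cong _ _ (λ i → subst (λ j → P i (π i) ⇔ P i j) (π≗π′ i) (⇔-id _))

countGraph-conjugate : (σ : Permutation′ m) {P Q : Fin m → Fin m → Set}
                       (P? : ∀ i j → Dec (P i j)) (Q? : ∀ i j → Dec (Q i j)) →
                       (∀ i j → P (σ ⟨$⟩ʳ i) (σ ⟨$⟩ʳ j) ⇔ Q i j) →
                       ∀ π → countGraph m P? (conjugate σ π) ≡ countGraph m Q? π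
countGraph-conjugate σ {P} {Q} P? Q? P∘σ⇔Q π = countFin-reindex σ _ _ (λ i →
  subst (λ j → P (σ ⟨$⟩ʳ i) j ⇔ Q i (π i)) (sym (conjugate-⟨$⟩ʳ σ π i)) (P∘σ⇔Q i (π i)))

fixed? : (i j : Fin m) → Dec (val j ≡ val i)
fixed? i j = val j ≟ℕ val i

fix-cong : {π π′ : Fin m → Fin m} → (∀ i → π i ≡ π′ i) → fix m π ≡ fix m π′
fix-cong = countGraph-cong fixed?

val-≡-⇔ : {i j : Fin m} → val i ≡ val j ⇔ i ≡ j
val-≡-⇔ = mk⇔ (toℕ-injective ∘ suc-injective) (cong val)

fix-conjugate : (σ : Permutation′ m) (π : Fin m → Fin m) → fix m (conjugate σ π) ≡ fix m π
fix-conjugate σ =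
  countGraph-conjugate σ fixed? fixed? (λ i j → ⇔-sym val-≡-⇔ ⇔-∘ (σ-injective ⇔-∘ val-≡-⇔))
  where
  σ-injective : ∀ {i j} → σ ⟨$⟩ʳ j ≡ σ ⟨$⟩ʳ i ⇔ j ≡ i
  σ-injective = mk⇔ (⟨$⟩ʳ-injective σ) (cong (σ ⟨$⟩ʳ_))

restrict : (f : ℕ → ℕ) → (∀ {x} → x < m → f x < m) → Fin m → Fin m
restrict f f< i = fromℕ< (f< (toℕ<n i))

toℕ-restrict : (f : ℕ → ℕ) (f< : ∀ {x} → x < m → f x < m) (i : Fin m) → toℕ (restrict f f< i) ≡ f (toℕ i)
toℕ-restrict f f< i = toℕ-fromℕ< (f< (toℕ<n i))

restrict-inverse : (f g : ℕ → ℕ) (f< : ∀ {x} → x < m → f x < m) (g< : ∀ {y} → y < m → g y < m) →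
                   (∀ {x} → x < m → g (f x) ≡ x) → ∀ i → restrict g g< (restrict f f< i) ≡ i
restrict-inverse f g f< g< gf i = toℕ-injective (begin
  toℕ (restrict g g< (restrict f f< i)) ≡⟨ toℕ-restrict g g< _ ⟩
  g (toℕ (restrict f f< i))              ≡⟨ cong g (toℕ-restrict f f< i) ⟩
  g (f (toℕ i))                          ≡⟨ gf (toℕ<n i) ⟩
  toℕ i                                  ∎)
  where open ≡-Reasoning

permutationFromℕ : (f g : ℕ → ℕ) (f< : ∀ {x} → x < m → f x < m) (g< : ∀ {y} → y < m → g y < m) →
                   (∀ {y} → y < m → f (g y) ≡ y) → (∀ {x} → x < m → g (f x) ≡ x) → Permutation′ m
permutationFromℕ f g f< g< fg gf =
  mk↔ₛ′ (restrict f f<) (restrict g g<) (restrict-inverse g f g< f< fg) (restrict-inverse f g f< g< gf)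

toList-unique⁺ : {v : Vec A k} → Vec.Unique v → Unique (toList v)
toList-unique⁺ [] = []
toList-unique⁺ (px ∷ pxs) = VecAllₚ.toList⁺ px ∷ toList-unique⁺ pxs

toList-unique⁻ : {v : Vec A k} → Unique (toList v) → Vec.Unique v
toList-unique⁻ {v = []ᵥ} [] = []
toList-unique⁻ {v = x ∷ᵥ v} (px ∷ pxs) = VecAllₚ.toList⁻ px ∷ toList-unique⁻ pxs

allVecs-complete : ∀ k m (v : Vec (Fin m) k) → v ∈ allVecs k m
allVecs-complete zero m []ᵥ = here refl
allVecs-complete (suc k) m (x ∷ᵥ v) =
  ∈-concatMap⁺ (λ w → map (_∷ᵥ w) (allFin m))
    (Any.map (λ { refl → ∈-map⁺ (_∷ᵥ v) (∈-allFin x) }) (allVecs-complete k m v))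

allVecs-unique : ∀ k m → Unique (allVecs k m)
allVecs-unique zero m = [] ∷ []
allVecs-unique (suc k) m =
  Uniqueₚ.concat⁺ (Allₚ.map⁺ (All.universal (λ _ → Uniqueₚ.map⁺ ∷-injectiveˡ (Uniqueₚ.allFin⁺ m)) _))
                  (AllPairsₚ.map⁺ (AllPairs.map tails-disjoint (allVecs-unique k m)))
  where
  tails-disjoint : ∀ {v w} → v ≢ w → Disjoint (map (_∷ᵥ v) (allFin m)) (map (_∷ᵥ w) (allFin m))
  tails-disjoint v≢w (z∈v , z∈w) with ∈-map⁻ _ z∈v | ∈-map⁻ _ z∈w
  ... | _ , _ , refl | _ , _ , x∷v≡y∷w = v≢w (∷-injectiveʳ x∷v≡y∷w)

uniqueEntries? : (v : Vec (Fin m) k) → Dec (Unique (toList v))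
uniqueEntries? = DecUnique.unique? _≟_ ∘ toList

permVecs : (m : ℕ) → List (Vec (Fin m) m)
permVecs m = filter uniqueEntries? (allVecs m m)

∈-permVecs⁺ : {v : Vec (Fin m) m} → Vec.Unique v → v ∈ permVecs m
∈-permVecs⁺ {m} {v} v! = ∈-filter⁺ uniqueEntries? (allVecs-complete m m v) (toList-unique⁺ v!)

∈-permVecs⁻ : {v : Vec (Fin m) m} → v ∈ permVecs m → Vec.Unique v
∈-permVecs⁻ {m} v∈ = toList-unique⁻ (proj₂ (∈-filter⁻ uniqueEntries? {xs = allVecs m m} v∈))

conjugateᵥ : Permutation′ m → Vec (Fin m) m → Vec (Fin m) m
conjugateᵥ σ v = tabulate (conjugate σ (lookup v))

conjugateᵥ-inverse : (σ : Permutation′ m) (v : Vec (Fin m) m) → conjugateᵥ (flip σ) (conjugateᵥ σ v) ≡ v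
conjugateᵥ-inverse σ v = trans (tabulate-cong cancel) (tabulate∘lookup v)
  where
  open ≡-Reasoning
  cancel : ∀ i → σ ⟨$⟩ˡ lookup (conjugateᵥ σ v) (σ ⟨$⟩ʳ i) ≡ lookup v i
  cancel i = begin
    σ ⟨$⟩ˡ lookup (conjugateᵥ σ v) (σ ⟨$⟩ʳ i) ≡⟨ cong (σ ⟨$⟩ˡ_) (lookup∘tabulate _ (σ ⟨$⟩ʳ i)) ⟩
    σ ⟨$⟩ˡ (σ ⟨$⟩ʳ lookup v (σ ⟨$⟩ˡ (σ ⟨$⟩ʳ i))) ≡⟨ inverseˡ σ ⟩
    lookup v (σ ⟨$⟩ˡ (σ ⟨$⟩ʳ i))               ≡⟨ cong (lookup v) (inverseˡ σ) ⟩
    lookup v i                                 ∎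

conjugateᵥ-unique : (σ : Permutation′ m) {v : Vec (Fin m) m} → Vec.Unique v → Vec.Unique (conjugateᵥ σ v)
conjugateᵥ-unique σ {v} v! = VecUniqueₚ.tabulate⁺
  (⟨$⟩ʳ-injective (flip σ) ∘ VecUniqueₚ.lookup-injective v! _ _ ∘ ⟨$⟩ʳ-injective σ)

permVecs-conjugate-↭ : (σ : Permutation′ m) → map (conjugateᵥ σ) (permVecs m) ↭ permVecs m
permVecs-conjugate-↭ {m} σ =
  map-bijection-↭ (conjugateᵥ σ) (conjugateᵥ (flip σ))
    (Uniqueₚ.filter⁺ uniqueEntries? (allVecs-unique m m))
    (conjugateᵥ-inverse σ) (conjugateᵥ-inverse (flip σ))
    (∈-permVecs⁺ ∘ conjugateᵥ-unique σ ∘ ∈-permVecs⁻)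
    (∈-permVecs⁺ ∘ conjugateᵥ-unique (flip σ) ∘ ∈-permVecs⁻)

module _ {c ℓ : Level} (𝓡 : CommutativeSemiring c ℓ) where
  open CommutativeSemiring 𝓡 using (Carrier; _≈_; 0#; setoid; isEquivalence; +-isCommutativeMonoid)
    renaming (_+_ to _⊕_; _*_ to _·_)
  open import Relation.Binary.Reasoning.Setoid setoid

  sum : List Carrier → Carrier
  sum = foldr _⊕_ 0#

  sum-↭ : {xs ys : List Carrier} → xs ↭ ys → sum xs ≈ sum ys
  sum-↭ = foldr-commMonoid setoid +-isCommutativeMonoid ∘ ↭⇒↭ₛ′ isEquivalence

  weight : ((Fin m → Fin m) → ℕ) → Carrier → Carrier → (Fin m → Fin m) → Carrier
  weight {m} stat t y π = pow 𝓡 t (stat π) · pow 𝓡 y (fix m π)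

  genPoly≡sum : (stat : (Fin m → Fin m) → ℕ) (t y : Carrier) →
                genPoly 𝓡 m stat t y ≡ sum (map (weight stat t y ∘ lookup) (permVecs m))
  genPoly≡sum {m} stat t y =
    trans (foldr-map _ lookup 0# (permVecs m))
          (sym (foldr-map _⊕_ (weight stat t y ∘ lookup) 0# (permVecs m)))

  genPoly-conjugate : (σ : Permutation′ m) {P Q : Fin m → Fin m → Set}
                      (P? : ∀ i j → Dec (P i j)) (Q? : ∀ i j → Dec (Q i j)) →
                      (∀ i j → P (σ ⟨$⟩ʳ i) (σ ⟨$⟩ʳ j) ⇔ Q i j) → (t y : Carrier) →
                      genPoly 𝓡 m (countGraph m P?) t y ≈ genPoly 𝓡 m (countGraph m Q?) t y
  genPoly-conjugate {m} σ P? Q? P∘σ⇔Q t y = begin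
    genPoly 𝓡 m (countGraph m P?) t y              ≡⟨ genPoly≡sum (countGraph m P?) t y ⟩
    sum (map (wP ∘ lookup) (permVecs m))
      ≈⟨ sum-↭ (↭-map⁺ (wP ∘ lookup) (↭-sym (permVecs-conjugate-↭ σ))) ⟩
    sum (map (wP ∘ lookup) (map (conjugateᵥ σ) (permVecs m)))
      ≡⟨ cong sum (trans (sym (map-∘ (permVecs m))) (map-cong weight-conjugate (permVecs m))) ⟩
    sum (map (wQ ∘ lookup) (permVecs m))           ≡⟨ genPoly≡sum (countGraph m Q?) t y ⟨
    genPoly 𝓡 m (countGraph m Q?) t y              ∎
    where
    wP wQ : (Fin m → Fin m) → Carrier
    wP = weight (countGraph m P?) t y
    wQ = weight (countGraph m Q?) t y
    weight-conjugate : ∀ v → wP (lookup (conjugateᵥ σ v)) ≡ wQ (lookup v)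
    weight-conjugate v = cong₂ (λ k l → pow 𝓡 t k · pow 𝓡 y l)
      (trans (countGraph-cong P? lookup-conj) (countGraph-conjugate σ P? Q? P∘σ⇔Q (lookup v)))
      (trans (fix-cong lookup-conj) (fix-conjugate σ (lookup v)))
      where
      lookup-conj : ∀ i → lookup (conjugateᵥ σ v) i ≡ conjugate σ (lookup v) i
      lookup-conj = lookup∘tabulate (conjugate σ (lookup v))

double : ℕ → ℕ
double zero = zero
double (suc a) = suc (suc (double a))

double≡2* : ∀ n → double n ≡ 2 * n
double≡2* zero = refl
double≡2* (suc n) = cong suc (trans (cong suc (double≡2* n)) (sym (+-suc n (n + 0))))

double-mono-≤ : ∀ {a b} → a ≤ b → double a ≤ double b
double-mono-≤ z≤n = z≤n
double-mono-≤ (s≤s a≤b) = s≤s (s≤s (double-mono-≤ a≤b))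

double-cancel-≤ : ∀ {a b} → double a ≤ double b → a ≤ b
double-cancel-≤ {zero} _ = z≤n
double-cancel-≤ {suc a} {suc b} (s≤s (s≤s h)) = s≤s (double-cancel-≤ h)

suc-double-cancel-≤ : ∀ {a b} → suc (double a) ≤ double b → a < b
suc-double-cancel-≤ {zero} {suc b} _ = s≤s z≤n
suc-double-cancel-≤ {suc a} {suc b} (s≤s (s≤s h)) = s≤s (suc-double-cancel-≤ h)

double-≤-⇔ : ∀ {a b} → double a ≤ double b ⇔ a ≤ b
double-≤-⇔ = mk⇔ double-cancel-≤ double-mono-≤

double-<-⇔ : ∀ {a b} → double a < double b ⇔ a < b
double-<-⇔ = mk⇔ suc-double-cancel-≤ (λ a<b → ≤-trans (n≤1+n _) (double-mono-≤ a<b))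

s≤s-⇔ : ∀ {a b} → suc a ≤ suc b ⇔ a ≤ b
s≤s-⇔ = mk⇔ ≤-pred s≤s

-- 0-based form of σ: x ↦ 2x + 1 for x < n, and n + a ↦ 2a.
interleave : ℕ → ℕ → ℕ
interleave n x with x <? n
... | yes _ = suc (double x)
... | no _ = double (x ∸ n)

deinterleave : ℕ → ℕ → ℕ
deinterleave n zero = n
deinterleave n (suc zero) = zero
deinterleave n (suc (suc y)) = suc (deinterleave n y)

data Half (n : ℕ) : ℕ → Set where
  low : ∀ {a} → a < n → Half n a
  high : ∀ {a} → a < n → Half n (n + a)

half : ∀ n {x} → x < 2 * n → Half n x
half n {x} x<2n with x <? n
... | yes x<n = low x<n
... | no x≮n = subst (Half n) (m+[n∸m]≡n n≤x) (high x∸n<n)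
  where
  n≤x : n ≤ x
  n≤x = ≮⇒≥ x≮n
  x∸n<n : x ∸ n < n
  x∸n<n = subst (x ∸ n <_) (m+n∸m≡n n n)
            (∸-monoˡ-< (subst (x <_) (cong (n +_) (+-identityʳ n)) x<2n) n≤x)

data EvenOdd : ℕ → Set where
  even : ∀ a → EvenOdd (double a)
  odd : ∀ a → EvenOdd (suc (double a))

evenOdd : ∀ y → EvenOdd y
evenOdd zero = even zero
evenOdd (suc zero) = odd zero
evenOdd (suc (suc y)) with evenOdd y
... | even a = even (suc a)
... | odd a = odd (suc a)

interleave-low : ∀ {n a} → a < n → interleave n a ≡ suc (double a)
interleave-low {n} {a} a<n with a <? n
... | yes _ = refl
... | no a≮n = contradiction a<n a≮n

interleave-high : ∀ n a → interleave n (n + a) ≡ double a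
interleave-high n a with n + a <? n
... | yes n+a<n = contradiction (m≤m+n n a) (<⇒≱ n+a<n)
... | no _ = cong double (m+n∸m≡n n a)

deinterleave-double : ∀ n a → deinterleave n (double a) ≡ n + a
deinterleave-double n zero = sym (+-identityʳ n)
deinterleave-double n (suc a) = trans (cong suc (deinterleave-double n a)) (sym (+-suc n a))

deinterleave-suc-double : ∀ n a → deinterleave n (suc (double a)) ≡ a
deinterleave-suc-double n zero = refl
deinterleave-suc-double n (suc a) = cong suc (deinterleave-suc-double n a)

deinterleave-interleave : ∀ n {x} → x < 2 * n → deinterleave n (interleave n x) ≡ x
deinterleave-interleave n x<2n with half n x<2n
... | low {a} a<n = trans (cong (deinterleave n) (interleave-low a<n)) (deinterleave-suc-double n a)
... | high {a} _ = trans (cong (deinterleave n) (interleave-high n a)) (deinterleave-double n a)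

<-double⇒<-2* : ∀ n {x} → x < double n → x < 2 * n
<-double⇒<-2* n {x} = subst (x <_) (double≡2* n)

<-2*⇒<-double : ∀ n {x} → x < 2 * n → x < double n
<-2*⇒<-double n {x} = subst (x <_) (sym (double≡2* n))

half-< : ∀ {n x} → Half n x → x < 2 * n
half-< {n} (low a<n) = <-≤-trans a<n (m≤m+n n (n + 0))
half-< {n} (high a<n) = +-monoʳ-< n (<-≤-trans a<n (m≤m+n n 0))

interleave-< : ∀ n {x} → x < 2 * n → interleave n x < 2 * n
interleave-< n x<2n with half n x<2n
... | low {a} a<n =
  <-double⇒<-2* n (subst (_< double n) (sym (interleave-low a<n)) (double-mono-≤ a<n))
... | high {a} a<n =
  <-double⇒<-2* n (subst (_< double n) (sym (interleave-high n a)) (Equivalence.from double-<-⇔ a<n))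

deinterleave-half : ∀ n {y} → y < 2 * n → Half n (deinterleave n y)
deinterleave-half n {y} y<2n with evenOdd y
... | even a rewrite deinterleave-double n a = high (suc-double-cancel-≤ (<-2*⇒<-double n y<2n))
... | odd a rewrite deinterleave-suc-double n a = low (double-cancel-≤ (<-2*⇒<-double n y<2n))

deinterleave-< : ∀ n {y} → y < 2 * n → deinterleave n y < 2 * n
deinterleave-< n = half-< ∘ deinterleave-half n

interleave-deinterleave : ∀ n {y} → y < 2 * n → interleave n (deinterleave n y) ≡ y
interleave-deinterleave n {y} y<2n with evenOdd y
... | even a = trans (cong (interleave n) (deinterleave-double n a)) (interleave-high n a)
... | odd a = trans (cong (interleave n) (deinterleave-suc-double n a))
                    (interleave-low (double-cancel-≤ (<-2*⇒<-double n y<2n)))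

ExphAt : ℕ → ℕ → ℕ → Set
ExphAt n i p = ((i < p) × (p ≤ n))
             ⊎ (((n < i) × ((i ≤ p + n) × (p ≤ n)))
             ⊎ (((n < i) × (i < p))
             ⊎ ((i + n < p) × (n < p))))

module _ {n a b : ℕ} where

  exphAt-low-low : a < n → b < n → ExphAt n (suc a) (suc b) ⇔ a < b
  exphAt-low-low a<n b<n = mk⇔ to (λ a<b → inj₁ (s≤s a<b , b<n))
    where
    to : ExphAt n (suc a) (suc b) → a < b
    to (inj₁ (s≤s a<b , _)) = a<b
    to (inj₂ (inj₁ (s≤s n≤a , _))) = contradiction n≤a (<⇒≱ a<n)
    to (inj₂ (inj₂ (inj₁ (s≤s n≤a , _)))) = contradiction n≤a (<⇒≱ a<n)
    to (inj₂ (inj₂ (inj₂ (_ , s≤s n≤b)))) = contradiction n≤b (<⇒≱ b<n)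

  exphAt-high-low : b < n → ExphAt n (suc (n + a)) (suc b) ⇔ a ≤ b
  exphAt-high-low b<n = mk⇔ to from
    where
    n+a≮b : ¬ (n + a < b)
    n+a≮b h = <⇒≱ b<n (≤-trans (m≤m+n n a) (<⇒≤ h))
    to : ExphAt n (suc (n + a)) (suc b) → a ≤ b
    to (inj₁ (s≤s h , _)) = contradiction h n+a≮b
    to (inj₂ (inj₁ (_ , s≤s h , _))) = +-cancelˡ-≤ n a b (subst (n + a ≤_) (+-comm b n) h)
    to (inj₂ (inj₂ (inj₁ (_ , s≤s h)))) = contradiction h n+a≮b
    to (inj₂ (inj₂ (inj₂ (_ , s≤s n≤b)))) = contradiction n≤b (<⇒≱ b<n)
    from : a ≤ b → ExphAt n (suc (n + a)) (suc b)
    from a≤b =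
      inj₂ (inj₁ (s≤s (m≤m+n n a) , s≤s (subst (n + a ≤_) (+-comm n b) (+-monoʳ-≤ n a≤b)) , b<n))

  exphAt-high-high : b < n → ExphAt n (suc (n + a)) (suc (n + b)) ⇔ a < b
  exphAt-high-high b<n = mk⇔ to (λ a<b → inj₂ (inj₂ (inj₁ (s≤s (m≤m+n n a) , s≤s (+-monoʳ-< n a<b)))))
    where
    n<1+n+b : n < suc (n + b)
    n<1+n+b = s≤s (m≤m+n n b)
    to : ExphAt n (suc (n + a)) (suc (n + b)) → a < b
    to (inj₁ (_ , h)) = contradiction h (<⇒≱ n<1+n+b)
    to (inj₂ (inj₁ (_ , _ , h))) = contradiction h (<⇒≱ n<1+n+b)
    to (inj₂ (inj₂ (inj₁ (_ , s≤s h)))) = +-cancelˡ-< n a b h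
    to (inj₂ (inj₂ (inj₂ (s≤s h , _)))) =
      contradiction (<-trans h (+-monoʳ-< n b<n)) (≤⇒≯ (+-monoˡ-≤ n (m≤m+n n a)))

  exphAt-low-high : a < n → ExphAt n (suc a) (suc (n + b)) ⇔ a < b
  exphAt-low-high a<n = mk⇔ to from
    where
    to : ExphAt n (suc a) (suc (n + b)) → a < b
    to (inj₁ (_ , h)) = contradiction h (<⇒≱ (s≤s (m≤m+n n b)))
    to (inj₂ (inj₁ (s≤s n≤a , _))) = contradiction n≤a (<⇒≱ a<n)
    to (inj₂ (inj₂ (inj₁ (s≤s n≤a , _)))) = contradiction n≤a (<⇒≱ a<n)
    to (inj₂ (inj₂ (inj₂ (s≤s h , _)))) = +-cancelˡ-< n a b (subst (_< n + b) (+-comm a n) h)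
    from : a < b → ExphAt n (suc a) (suc (n + b))
    from a<b =
      inj₂ (inj₂ (inj₂ (s≤s (subst (_< n + b) (+-comm n a) (+-monoʳ-< n a<b)) , s≤s (m≤m+n n b))))

interleave-<-⇔ : ∀ n {x p} → x < 2 * n → p < 2 * n →
                 interleave n x < interleave n p ⇔ ExphAt n (suc x) (suc p)
interleave-<-⇔ n x<2n p<2n with half n x<2n | half n p<2n
... | low {a} a<n | low {b} b<n
  rewrite interleave-low a<n | interleave-low b<n =
  ⇔-sym (exphAt-low-low a<n b<n) ⇔-∘ (double-<-⇔ ⇔-∘ s≤s-⇔)
... | high {a} _ | low {b} b<n
  rewrite interleave-high n a | interleave-low b<n =
  ⇔-sym (exphAt-high-low b<n) ⇔-∘ (double-≤-⇔ ⇔-∘ s≤s-⇔)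
... | high {a} _ | high {b} b<n
  rewrite interleave-high n a | interleave-high n b =
  ⇔-sym (exphAt-high-high b<n) ⇔-∘ double-<-⇔
... | low {a} a<n | high {b} _
  rewrite interleave-low a<n | interleave-high n b =
  ⇔-sym (exphAt-low-high a<n) ⇔-∘ double-≤-⇔

interleaving : (n : ℕ) → Permutation′ (2 * n)
interleaving n = permutationFromℕ (interleave n) (deinterleave n) (interleave-< n) (deinterleave-< n)
  (interleave-deinterleave n) (deinterleave-interleave n)

interleaving-<-⇔ : (n : ℕ) (i j : Fin (2 * n)) →
                   val (interleaving n ⟨$⟩ʳ i) < val (interleaving n ⟨$⟩ʳ j) ⇔ ExphAt n (val i) (val j)
interleaving-<-⇔ n i j
  rewrite toℕ-restrict (interleave n) (interleave-< n) i
        | toℕ-restrict (interleave n) (interleave-< n) j =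
  interleave-<-⇔ n (toℕ<n i) (toℕ<n j) ⇔-∘ s≤s-⇔

theorem3p8 : {c ℓ : Level} (R : CommutativeSemiring c ℓ) (n : ℕ) → 1 ≤ n →
    (t y : CommutativeSemiring.Carrier R) →
    CommutativeSemiring._≈_ R (genPoly R (2 * n) (exc (2 * n)) t y) (genPoly R (2 * n) (exph n) t y)
theorem3p8 R n _ =
  genPoly-conjugate R (interleaving n) (λ i j → val i <? val j) (λ i j → exphAt n (val i) (val j))
    (interleaving-<-⇔ n)
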